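{- Let $(X,\rho)$ be a finite metric space and let $T$ be a tree with vertex set $X$ such that any two vertices are joined in $T$ by a path of at most 4 edges. Orient the edges of $T$ so that there is no directed path of length 2 $a\rightarrow b\rightarrow c$, and let $f:X\to\mathbb{R}$ be a function such that $f(a)-f(b)=\rho(a,b)$ for every oriented edge $a\rightarrow b$ of $T$. Then $f$ is 1-Lipschitz (i.e. $|f(x)-f(y)|\leq\rho(x,y)$ for all $x,y\in X$) if and only if for every path $a-b-c-d$ in the (non-oriented) tree $T$ one has $\rho(a,d)+\rho(b,c)\geq \rho(a,b)+\rho(c,d)$. -}

module Defs where

open import Level using (0ℓ)
open import Data.Nat using (ℕ; _≤_)
open import Data.Fin using (Fin)
open import Data.List using (List; []; _∷_; head; last; length)
open import Data.Maybe using (just)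
open import Data.Product using (_×_; ∃)
open import Data.Empty using (⊥)
open import Data.Sum using (_⊎_)
open import Relation.Nullary using (¬_)
open import Relation.Binary.PropositionalEquality using (_≡_; _≢_)
open import Relation.Binary.Structures using (IsTotalOrder)
open import Algebra.Structures using (IsAbelianGroup)
open import Data.List.Relation.Unary.Linked using (Linked)
open import Data.List.Relation.Unary.Unique.Propositional using (Unique)

-- A totally ordered abelian group (the value domain of distances and of f).
-- The reals form one; the theorem only uses +, -, ≤ on ℝ.
record OrderedAbelianGroup : Set₁ where
  infixl 6 _+_ _-_
  infix 4 _≤ᵍ_
  field
    Carrier : Set
    _+_     : Carrier → Carrier → Carrier
    0#      : Carrier
    -_      : Carrier → Carrier
    _≤ᵍ_    : Carrier → Carrier → Set
    isAbelianGroup : IsAbelianGroup _≡_ _+_ 0# -_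
    isTotalOrder   : IsTotalOrder _≡_ _≤ᵍ_
    +-monoˡ-≤      : ∀ {x y} z → x ≤ᵍ y → x + z ≤ᵍ y + z

  _-_ : Carrier → Carrier → Carrier
  x - y = x + (- y)

module _ (G : OrderedAbelianGroup) where
  open OrderedAbelianGroup G

  record IsMetric {n : ℕ} (ρ : Fin n → Fin n → Carrier) : Set where
    field
      dist-self  : ∀ x → ρ x x ≡ 0#
      dist-zero  : ∀ x y → ρ x y ≡ 0# → x ≡ y
      dist-sym   : ∀ x y → ρ x y ≡ ρ y x
      dist-tri   : ∀ x y z → ρ x z ≤ᵍ ρ x y + ρ y z

  OneLipschitz : {n : ℕ} → (Fin n → Fin n → Carrier) → (Fin n → Carrier) → Set
  OneLipschitz ρ f = ∀ x y → (f x - f y ≤ᵍ ρ x y) × (- ρ x y ≤ᵍ f x - f y)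

module _ {n : ℕ} (Adj : Fin n → Fin n → Set) where

  IsPath : List (Fin n) → Set
  IsPath ps = Linked Adj ps × Unique ps

  -- ps is a path from x to y (its number of edges is length ps ∸ 1)
  IsPathBetween : Fin n → Fin n → List (Fin n) → Set
  IsPathBetween x y ps = IsPath ps × head ps ≡ just x × last ps ≡ just y

  IsCycle : List (Fin n) → Set
  IsCycle [] = ⊥
  IsCycle (v ∷ rest) =
    IsPath (v ∷ rest) × 3 ≤ length (v ∷ rest) × ∃ λ w → last (v ∷ rest) ≡ just w × Adj w v

  record IsTree : Set where
    field
      adj-sym    : ∀ x y → Adj x y → Adj y x
      adj-irrefl : ∀ x → ¬ Adj x x
      connected  : ∀ x y → ∃ λ ps → IsPathBetween x y ps
      acyclic    : ∀ ps → ¬ IsCycle ps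

  -- any two vertices are joined by a path with at most 4 edges (≤ 5 vertices)
  DiameterAtMost4 : Set
  DiameterAtMost4 = ∀ x y → ∃ λ ps → IsPathBetween x y ps × length ps ≤ 5

  record IsOrientation (Or : Fin n → Fin n → Set) : Set where
    field
      or-edge  : ∀ a b → Or a b → Adj a b
      or-total : ∀ a b → Adj a b → Or a b ⊎ Or b a
      or-anti  : ∀ a b → Or a b → ¬ Or b a

  NoDirectedPath2 : (Fin n → Fin n → Set) → Set
  NoDirectedPath2 Or = ∀ a b c → Or a b → Or b c → ⊥

-- Every vertex of the tree is a source or a sink, so orientations alternate along paths.
-- Along a zigzag a → b ← c → d the edge equations give f a − f d = ρ a b − ρ b c + ρ c d,
-- so the Lipschitz bound f a − f d ≤ ρ a d is exactly the four-point inequality for the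
-- path a b c d, and every path with three edges is a zigzag read in one direction or the
-- other. Conversely, by the triangle inequality a bound f b − f y ≤ ρ b y passes to x when
-- b → x, and a bound f x − f d ≤ ρ x d passes to y when y → d; peeling such end edges off a
-- path with at most 4 edges from x to y leaves a single vertex, an edge, or a zigzag.
module Submission where

open import Defs
open import Level using (0ℓ)
open import Data.Nat using (ℕ; zero; suc; _≤_; s≤s)
open import Data.Fin using (Fin)
open import Data.List using ([]; _∷_; length; take)
open import Data.Product using (_×_; _,_; proj₁)
open import Data.Sum using (_⊎_; inj₁; inj₂)
open import Data.Empty using (⊥-elim)
open import Function.Base using (_∘_)
open import Function.Bundles using (_⇔_; mk⇔; Equivalence)
open import Algebra.Bundles using (AbelianGroup; CommutativeMonoid)
open import Algebra.Structures using (IsAbelianGroup)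
open import Relation.Binary.Bundles using (Poset)
open import Relation.Binary.Structures using (IsTotalOrder)
open import Relation.Binary.PropositionalEquality
  using (_≡_; refl; sym; trans; cong; cong₂; subst; subst₂; module ≡-Reasoning)
open import Data.List.Relation.Unary.Linked as Linked using (Linked; []; [-]; _∷_)
import Data.List.Relation.Unary.Unique.Propositional.Properties as Unique
import Algebra.Properties.AbelianGroup as AbelianGroupProperties
import Algebra.Properties.CommutativeSemigroup as CommutativeSemigroupProperties
import Relation.Binary.Reasoning.PartialOrder as PartialOrderReasoning

open Equivalence using (to; from)

module OrderedAbelianGroupProperties (G : OrderedAbelianGroup) where
  open OrderedAbelianGroup G
  open IsAbelianGroup isAbelianGroup using (comm)
  open IsTotalOrder isTotalOrder using (isPartialOrder)

  abelianGroup : AbelianGroup 0ℓ 0ℓ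
  abelianGroup = record { isAbelianGroup = isAbelianGroup }

  poset : Poset 0ℓ 0ℓ 0ℓ
  poset = record { isPartialOrder = isPartialOrder }

  open AbelianGroupProperties abelianGroup public
    using (//-rightDividesˡ; //-rightDividesʳ; \\-leftDividesʳ)
  open CommutativeSemigroupProperties
    (CommutativeMonoid.commutativeSemigroup (AbelianGroup.commutativeMonoid abelianGroup)) public
    using (x∙yz≈y∙xz; x∙yz≈xz∙y; xy∙z≈x∙zy; xy∙z≈yz∙x)
  module ≤-Reasoning = PartialOrderReasoning poset

  +-cancelʳ-≤ : ∀ c {a b} → a + c ≤ᵍ b + c → a ≤ᵍ b
  +-cancelʳ-≤ c {a} {b} p =
    subst₂ _≤ᵍ_ (//-rightDividesʳ c a) (//-rightDividesʳ c b) (+-monoˡ-≤ (- c) p)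

  balanced-≤ : ∀ {a b a′ b′} → a + b′ ≡ b + a′ → a ≤ᵍ b → a′ ≤ᵍ b′
  balanced-≤ {a} {b} {a′} {b′} e a≤b =
    +-cancelʳ-≤ b (subst₂ _≤ᵍ_ (trans e (comm b a′)) (comm b b′) (+-monoˡ-≤ b′ a≤b))

  balanced-≤⇔ : ∀ {a b a′ b′} → a + b′ ≡ b + a′ → (a ≤ᵍ b ⇔ a′ ≤ᵍ b′)
  balanced-≤⇔ {a} {b} {a′} {b′} e =
    mk⇔ (balanced-≤ e) (balanced-≤ (trans (comm a′ b) (trans (sym e) (comm a b′))))

  x-y≤z⇔x≤z+y : ∀ x y z → (x - y ≤ᵍ z ⇔ x ≤ᵍ z + y)
  x-y≤z⇔x≤z+y x y z = mk⇔
    (λ p → subst (_≤ᵍ z + y) (//-rightDividesˡ y x) (+-monoˡ-≤ y p))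
    (λ p → +-cancelʳ-≤ y (subst (_≤ᵍ z + y) (sym (//-rightDividesˡ y x)) p))

  -z≤x-y⇔y≤z+x : ∀ x y z → (- z ≤ᵍ x - y ⇔ y ≤ᵍ z + x)
  -z≤x-y⇔y≤z+x x y z =
    balanced-≤⇔ (trans (\\-leftDividesʳ z x) (sym (//-rightDividesˡ y x)))

module _ {a} {A : Set a} {R : A → A → Set} where

  Linked-take⁺ : ∀ k {xs} → Linked R xs → Linked R (take k xs)
  Linked-take⁺ zero          _        = []
  Linked-take⁺ (suc k)       []       = []
  Linked-take⁺ (suc zero)    [-]      = [-]
  Linked-take⁺ (suc zero)    (_ ∷ _)  = [-]
  Linked-take⁺ (suc (suc k)) [-]      = [-]
  Linked-take⁺ (suc (suc k)) (r ∷ rs) = r ∷ Linked-take⁺ (suc k) rs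

module _ {n : ℕ} {Adj : Fin n → Fin n → Set} where

  IsPath-take : ∀ k {ps} → IsPath Adj ps → IsPath Adj (take k ps)
  IsPath-take k (linked , unique) = Linked-take⁺ k linked , Unique.take⁺ k unique

  IsPath-tail : ∀ {p ps} → IsPath Adj (p ∷ ps) → IsPath Adj ps
  IsPath-tail (linked , unique) = Linked.tail linked , Unique.drop⁺ 1 unique

module SourcesAndSinks {n : ℕ} {Adj Or : Fin n → Fin n → Set}
  (orientation : IsOrientation Adj Or) (noPath2 : NoDirectedPath2 Adj Or) where
  open IsOrientation orientation

  sink-adj : ∀ {a b c} → Or a b → Adj b c → Or c b
  sink-adj {a} {b} {c} a→b bc with or-total b c bc
  ... | inj₁ b→c = ⊥-elim (noPath2 a b c a→b b→c)
  ... | inj₂ c→b = c→b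

  source-adj : ∀ {a b c} → Or b a → Adj b c → Or b c
  source-adj {a} {b} {c} b→a bc with or-total b c bc
  ... | inj₁ b→c = b→c
  ... | inj₂ c→b = ⊥-elim (noPath2 c b a c→b b→a)

  Zigzag : Fin n → Fin n → Fin n → Fin n → Set
  Zigzag a b c d = Or a b × Or c b × Or c d

  zigzag-or-reverse : ∀ {a b c d} → Adj a b → Adj b c → Adj c d →
                      Zigzag a b c d ⊎ Zigzag d c b a
  zigzag-or-reverse {a} {b} ab bc cd with or-total a b ab
  ... | inj₁ a→b = let c→b = sink-adj a→b bc in inj₁ (a→b , c→b , source-adj c→b cd)
  ... | inj₂ b→a = let b→c = source-adj b→a bc in inj₂ (sink-adj b→c cd , b→c , b→a)

module Lipschitz (G : OrderedAbelianGroup) {n : ℕ}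
  (ρ : Fin n → Fin n → OrderedAbelianGroup.Carrier G) (metric : IsMetric G ρ)
  (f : Fin n → OrderedAbelianGroup.Carrier G) where
  open OrderedAbelianGroup G
  open OrderedAbelianGroupProperties G
  open IsAbelianGroup isAbelianGroup using (comm; assoc; identityˡ)
  open IsTotalOrder isTotalOrder using (reflexive)
  open IsMetric metric

  Lip : Fin n → Fin n → Set
  Lip x y = f x ≤ᵍ ρ x y + f y

  FourPoint : Fin n → Fin n → Fin n → Fin n → Set
  FourPoint a b c d = ρ a b + ρ c d ≤ᵍ ρ a d + ρ b c

  oneLipschitz⇔Lip : OneLipschitz G ρ f ⇔ (∀ x y → Lip x y)
  oneLipschitz⇔Lip = mk⇔
    (λ lip x y → to (x-y≤z⇔x≤z+y (f x) (f y) (ρ x y)) (proj₁ (lip x y)))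
    (λ lip x y → from (x-y≤z⇔x≤z+y (f x) (f y) (ρ x y)) (lip x y) ,
                 from (-z≤x-y⇔y≤z+x (f x) (f y) (ρ x y))
                      (subst (λ r → f y ≤ᵍ r + f x) (dist-sym y x) (lip y x)))

  Lip-refl : ∀ x → Lip x x
  Lip-refl x = reflexive (trans (sym (identityˡ (f x))) (cong (_+ f x) (sym (dist-self x))))

  FourPoint-reverse : ∀ {a b c d} → FourPoint d c b a → FourPoint a b c d
  FourPoint-reverse {a} {b} {c} {d} = subst₂ _≤ᵍ_
    (trans (comm (ρ d c) (ρ b a)) (cong₂ _+_ (dist-sym b a) (dist-sym d c)))
    (cong₂ _+_ (dist-sym d a) (dist-sym c b))

  module Oriented {Or : Fin n → Fin n → Set}
    (f-edge : ∀ a b → Or a b → f a - f b ≡ ρ a b) where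

    edge : ∀ {a b} → Or a b → f a ≡ ρ a b + f b
    edge {a} {b} a→b = trans (sym (//-rightDividesˡ (f b) (f a))) (cong (_+ f b) (f-edge a b a→b))

    Lip-edge : ∀ {x y} → Or x y → Lip x y
    Lip-edge = reflexive ∘ edge

    Lip-sinkˡ : ∀ {b x y} → Or b x → Lip b y → Lip x y
    Lip-sinkˡ {b} {x} {y} b→x lip = +-cancelʳ-≤ (ρ b x) (begin
      f x + ρ b x           ≡⟨ comm (f x) (ρ b x) ⟩
      ρ b x + f x           ≡⟨ sym (edge b→x) ⟩
      f b                   ≤⟨ lip ⟩
      ρ b y + f y           ≤⟨ +-monoˡ-≤ (f y) (dist-tri b x y) ⟩
      ρ b x + ρ x y + f y   ≡⟨ xy∙z≈yz∙x (ρ b x) (ρ x y) (f y) ⟩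
      ρ x y + f y + ρ b x   ∎)
      where open ≤-Reasoning

    Lip-sourceʳ : ∀ {x y d} → Or y d → Lip x d → Lip x y
    Lip-sourceʳ {x} {y} {d} y→d lip = begin
      f x                   ≤⟨ lip ⟩
      ρ x d + f d           ≤⟨ +-monoˡ-≤ (f d) (dist-tri x y d) ⟩
      ρ x y + ρ y d + f d   ≡⟨ assoc (ρ x y) (ρ y d) (f d) ⟩
      ρ x y + (ρ y d + f d) ≡⟨ cong (ρ x y +_) (sym (edge y→d)) ⟩
      ρ x y + f y           ∎
      where open ≤-Reasoning

    module Alternating {Adj : Fin n → Fin n → Set}
      (orientation : IsOrientation Adj Or) (noPath2 : NoDirectedPath2 Adj Or) where
      open SourcesAndSinks orientation noPath2
      open IsOrientation orientation using (or-total)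

      zigzag-potential : ∀ {a b c d} → Zigzag a b c d → f a + ρ b c ≡ ρ a b + ρ c d + f d
      zigzag-potential {a} {b} {c} {d} (a→b , c→b , c→d) = begin
        f a + ρ b c           ≡⟨ cong (_+ ρ b c) (edge a→b) ⟩
        ρ a b + f b + ρ b c   ≡⟨ xy∙z≈x∙zy (ρ a b) (f b) (ρ b c) ⟩
        ρ a b + (ρ b c + f b) ≡⟨ cong (λ r → ρ a b + (r + f b)) (dist-sym b c) ⟩
        ρ a b + (ρ c b + f b) ≡⟨ cong (ρ a b +_) (sym (edge c→b)) ⟩
        ρ a b + f c           ≡⟨ cong (ρ a b +_) (edge c→d) ⟩
        ρ a b + (ρ c d + f d) ≡⟨ assoc (ρ a b) (ρ c d) (f d) ⟨
        ρ a b + ρ c d + f d   ∎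
        where open ≡-Reasoning

      Lip⇔FourPoint : ∀ {a b c d} → Zigzag a b c d → (Lip a d ⇔ FourPoint a b c d)
      Lip⇔FourPoint {a} {b} {c} {d} zigzag = balanced-≤⇔ (begin
        f a + (ρ a d + ρ b c)         ≡⟨ x∙yz≈y∙xz (f a) (ρ a d) (ρ b c) ⟩
        ρ a d + (f a + ρ b c)         ≡⟨ cong (ρ a d +_) (zigzag-potential zigzag) ⟩
        ρ a d + (ρ a b + ρ c d + f d) ≡⟨ x∙yz≈xz∙y (ρ a d) (ρ a b + ρ c d) (f d) ⟩
        ρ a d + f d + (ρ a b + ρ c d) ∎)
        where open ≡-Reasoning

      Lip⇒FourPoint : (∀ x y → Lip x y) →
        ∀ a b c d → IsPath Adj (a ∷ b ∷ c ∷ d ∷ []) → FourPoint a b c d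
      Lip⇒FourPoint lip a b c d ((ab ∷ bc ∷ cd ∷ [-]) , _)
        with zigzag-or-reverse ab bc cd
      ... | inj₁ zigzag = to (Lip⇔FourPoint zigzag) (lip a d)
      ... | inj₂ zigzag = FourPoint-reverse (to (Lip⇔FourPoint zigzag) (lip d a))

      module _ (fourPoint : ∀ a b c d → IsPath Adj (a ∷ b ∷ c ∷ d ∷ []) → FourPoint a b c d)
        where

        Lip-along : ∀ ps {x y} → IsPathBetween Adj x y ps → length ps ≤ 5 → Lip x y
        Lip-along [] (_ , () , _) _
        Lip-along (x ∷ []) (_ , refl , refl) _ = Lip-refl x
        Lip-along (x ∷ y ∷ []) (((xy ∷ [-]) , _) , refl , refl) _ with or-total x y xy
        ... | inj₁ x→y = Lip-edge x→y
        ... | inj₂ y→x = Lip-sinkˡ y→x (Lip-refl y)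
        Lip-along (x ∷ b ∷ y ∷ []) (((xb ∷ by ∷ [-]) , _) , refl , refl) _ with or-total x b xb
        ... | inj₁ x→b = Lip-sourceʳ (sink-adj x→b by) (Lip-edge x→b)
        ... | inj₂ b→x = Lip-sinkˡ b→x (Lip-edge (source-adj b→x by))
        Lip-along (x ∷ b ∷ c ∷ y ∷ []) (path@((xb ∷ bc ∷ cy ∷ [-]) , _) , refl , refl) _
          with zigzag-or-reverse xb bc cy
        ... | inj₁ zigzag = from (Lip⇔FourPoint zigzag) (fourPoint x b c y path)
        ... | inj₂ (y→c , b→c , b→x) = Lip-sinkˡ b→x (Lip-sourceʳ y→c (Lip-edge b→c))
        Lip-along (x ∷ b ∷ c ∷ d ∷ y ∷ [])
                  (path@((xb ∷ bc ∷ cd ∷ dy ∷ [-]) , _) , refl , refl) _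
          with zigzag-or-reverse xb bc cd
        ... | inj₁ zigzag@(_ , _ , c→d) = Lip-sourceʳ (sink-adj c→d dy)
          (from (Lip⇔FourPoint zigzag) (fourPoint x b c d (IsPath-take 4 path)))
        ... | inj₂ (d→c , b→c , b→x) = Lip-sinkˡ b→x (from (Lip⇔FourPoint (b→c , d→c , d→y))
          (fourPoint b c d y (IsPath-tail path)))
          where d→y = source-adj d→c dy
        Lip-along (_ ∷ _ ∷ _ ∷ _ ∷ _ ∷ _ ∷ _) _ (s≤s (s≤s (s≤s (s≤s (s≤s ())))))

        FourPoint⇒Lip : DiameterAtMost4 Adj → ∀ x y → Lip x y
        FourPoint⇒Lip diameter x y with diameter x y
        ... | ps , between , short = Lip-along ps between short

mainTheorem3 : (G : OrderedAbelianGroup) → let open OrderedAbelianGroup G in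
    {n : ℕ} (ρ : Fin n → Fin n → Carrier) → IsMetric G ρ →
    (Adj : Fin n → Fin n → Set) → IsTree Adj → DiameterAtMost4 Adj →
    (Or : Fin n → Fin n → Set) → IsOrientation Adj Or → NoDirectedPath2 Adj Or →
    (f : Fin n → Carrier) → (∀ a b → Or a b → f a - f b ≡ ρ a b) →
    OneLipschitz G ρ f ⇔ (∀ a b c d → IsPath Adj (a ∷ b ∷ c ∷ d ∷ []) →
                            ρ a b + ρ c d ≤ᵍ ρ a d + ρ b c)
mainTheorem3 G ρ metric Adj _ diameter Or orientation noPath2 f f-edge =
  mk⇔ (Lip⇒FourPoint ∘ to oneLipschitz⇔Lip)
      (λ fourPoint → from oneLipschitz⇔Lip (FourPoint⇒Lip fourPoint diameter))
  where
  open Lipschitz G ρ metric f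
  open Oriented f-edge
  open Alternating orientation noPath2
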